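{- Let $k$, $n$, $a$ be integers with $a\ge 3$ and $(a-1)/2\le k\le (n-a-1)/2$. Let $H_{n,a}$ be the graph obtained from the disjoint union of a path $P_a$ on $a$ vertices with endpoints $u,v$ and a complete graph $K_{n-a}$ by adding the edge $uv$ and joining each of $u$ and $v$ to all vertices of $K_{n-a}$. Then every unbalanced signed graph $(H_{n,a},\sigma)$ with underlying graph $H_{n,a}$ contains a negative cycle of length $2k+1$.
   Context: A signed graph is a graph with a sign function $\sigma:E\to\{+1,-1\}$. The sign of a cycle is the product of the signs of its edges. A signed graph is balanced if it is switching equivalent to an all-positive signed graph (equivalently, all its cycles are positive), and unbalanced otherwise; switching at a vertex subset $U$ reverses the signs of all edges between $U$ and its complement. -}

module Defs where

open import Data.Nat using (ℕ; zero; suc; _+_; _*_; _≤_; _<_)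
open import Data.Fin using (Fin; toℕ; inject₁; fromℕ) renaming (zero to fzero; suc to fsuc)
open import Data.Bool using (Bool; true; false; _xor_)
open import Data.List using (List; foldr; map)
open import Data.List using () renaming (_∷_ to _∷ₗ_)
open import Data.Fin.Base using ()
open import Data.List.Base using (allFin)
open import Data.Product using (Σ; _×_)
open import Relation.Binary.PropositionalEquality using (_≡_; _≢_)
open import Relation.Nullary using (¬_)
open import Function.Definitions using (Injective)

-- Vertex i of H_{n,a} is identified with toℕ i ∈ {0,…,n-1}.
-- Path P_a : vertices 0,…,a-1, edges j — j+1;  u = 0, v = a-1.
-- K_{n-a} : vertices a,…,n-1.
data HAdjℕ (a : ℕ) : ℕ → ℕ → Set where
  path→  : ∀ {x} → suc x < a → HAdjℕ a x (suc x)
  path←  : ∀ {x} → suc x < a → HAdjℕ a (suc x) x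
  uv     : ∀ {y} → suc y ≡ a → HAdjℕ a 0 y
  vu     : ∀ {y} → suc y ≡ a → HAdjℕ a y 0
  clique : ∀ {x y} → a ≤ x → a ≤ y → x ≢ y → HAdjℕ a x y
  u-K    : ∀ {y} → a ≤ y → HAdjℕ a 0 y
  K-u    : ∀ {y} → a ≤ y → HAdjℕ a y 0
  v-K    : ∀ {x y} → suc x ≡ a → a ≤ y → HAdjℕ a x y
  K-v    : ∀ {x y} → suc x ≡ a → a ≤ y → HAdjℕ a y x

H : (n a : ℕ) → Fin n → Fin n → Set
H n a i j = HAdjℕ a (toℕ i) (toℕ j)

-- A signed graph on Fin n with underlying adjacency relation Adj:
-- σ i j = true means the edge ij is negative; σ is symmetric, and only its
-- values on edges matter.
Signature : ℕ → Set
Signature n = Fin n → Fin n → Bool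

Symmetric : ∀ {n} → Signature n → Set
Symmetric σ = ∀ i j → σ i j ≡ σ j i

-- Balanced: switching equivalent to the all-positive signature, i.e. there is
-- a switching set U (U i = true iff i ∈ U) such that after switching at U
-- every edge is positive.
Balanced : ∀ {n} → (Fin n → Fin n → Set) → Signature n → Set
Balanced {n} Adj σ =
  Σ (Fin n → Bool) λ U → ∀ i j → Adj i j → (σ i j xor (U i xor U j)) ≡ false

Unbalanced : ∀ {n} → (Fin n → Fin n → Set) → Signature n → Set
Unbalanced Adj σ = ¬ Balanced Adj σ

-- A cycle of length suc m: distinct vertices c 0, …, c m with c j ~ c (j+1)
-- and c m ~ c 0.
record Cycle {n} (Adj : Fin n → Fin n → Set) (m : ℕ) : Set where
  field
    vert    : Fin (suc m) → Fin n
    distinct : Injective _≡_ _≡_ vert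
    step    : ∀ (j : Fin m) → Adj (vert (inject₁ j)) (vert (fsuc j))
    close   : Adj (vert (fromℕ m)) (vert fzero)
open Cycle public

cycleSign : ∀ {n} {Adj : Fin n → Fin n → Set} {m} → Signature n → Cycle Adj m → Bool
cycleSign {m = m} σ C =
  foldr _xor_ (σ (vert C (fromℕ m)) (vert C fzero))
    (map (λ j → σ (vert C (inject₁ j)) (vert C (fsuc j))) (allFin m))

-- Switch so that the path edges 0–1–⋯–(v−1) and all edges from u = 0 to
-- Q = {v} ∪ K_{n−a} become positive; only the path edge (v−1)–v and the edges of the
-- clique Q are left, and |Q| ≥ 2k + 2.  Examine a finite family of (2k+1)-cycles; if
-- one of them is negative we are done.  Otherwise: the cycles u, q, p, F and u, r, p, F,
-- where F is a path of 2k − 2 further vertices of Q, share all edges but q–p and r–p, so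
-- the Q-edges at p all have the same sign, and hence all Q-edges have one common sign c.
-- The cycle u, v, v+1, …, v+2k−1 uses an odd number 2k − 1 of Q-edges, so c is
-- positive.  Finally the cycle 0, 1, …, 2k contains the edge (v−1)–v as its only
-- possibly negative edge, so it is positive too, and the signed graph is balanced.

module Submission where

open import Defs
open import Algebra.Bundles using (CommutativeRing)
open import Data.Bool using (Bool; true; false; _xor_)
open import Data.Bool.Properties
  using (xor-assoc; xor-comm; xor-same; xor-identityʳ; xor-∧-commutativeRing)
open import Algebra.Properties.CommutativeSemigroup
  (CommutativeRing.+-commutativeSemigroup xor-∧-commutativeRing) using (interchange)
open import Data.Fin using (Fin; toℕ; fromℕ<; fromℕ; inject₁; punchIn; punchOut)
  renaming (zero to fzero; suc to fsuc)
open import Data.Fin.Properties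
  using (toℕ-fromℕ<; fromℕ<-toℕ; toℕ-inject₁; toℕ-fromℕ; toℕ-injective; toℕ<n;
         fromℕ<-injective; punchIn-injective; punchInᵢ≢i; punchIn-punchOut)
open import Data.List using (foldr; map; tabulate)
open import Data.List.Properties using (map-tabulate)
open import Data.Nat
open import Data.Nat.Properties
open import Data.Nat.Tactic.RingSolver using (solve-∀)
open import Data.Product using (Σ; _,_; _×_; proj₁; proj₂)
open import Data.Sum using (_⊎_; inj₁; inj₂; [_,_]′; map₁)
open import Function using (_∘_; id)
open import Function.Definitions using (Injective)
open import Relation.Binary.Definitions using (tri<; tri≈; tri>)
open import Relation.Binary.PropositionalEquality
open import Relation.Nullary using (Dec; yes; no; contradiction; ¬?)
open import Relation.Nullary.Decidable using (_×-dec_)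

open ≡-Reasoning

xor-cancelˡ : ∀ x y → x xor (x xor y) ≡ y
xor-cancelˡ x y = trans (sym (xor-assoc x x y)) (cong (_xor y) (xor-same x))

xor≡false⇒≡ : ∀ {x y} → x xor y ≡ false → x ≡ y
xor≡false⇒≡ {x} {y} eq = begin
  x                  ≡⟨ sym (xor-identityʳ x) ⟩
  x xor false        ≡⟨ cong (x xor_) (sym (xor-same y)) ⟩
  x xor (y xor y)    ≡⟨ sym (xor-assoc x y y) ⟩
  (x xor y) xor y    ≡⟨ cong (_xor y) eq ⟩
  y                  ∎

xorSum : ℕ → (ℕ → Bool) → Bool
xorSum zero    f = false
xorSum (suc m) f = f 0 xor xorSum m (f ∘ suc)

foldr-xor-tabulate : ∀ m (g : Fin m → Bool) f c → (∀ i → g i ≡ f (toℕ i)) →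
                     foldr _xor_ c (tabulate g) ≡ xorSum m f xor c
foldr-xor-tabulate zero    g f c g≗f = refl
foldr-xor-tabulate (suc m) g f c g≗f = begin
  g fzero xor foldr _xor_ c (tabulate (g ∘ fsuc))
    ≡⟨ cong₂ _xor_ (g≗f fzero) (foldr-xor-tabulate m (g ∘ fsuc) (f ∘ suc) c (g≗f ∘ fsuc)) ⟩
  f 0 xor (xorSum m (f ∘ suc) xor c)
    ≡⟨ sym (xor-assoc (f 0) _ c) ⟩
  xorSum (suc m) f xor c
    ∎

xorSum-cong : ∀ m {f g} → (∀ i → i < m → f i ≡ g i) → xorSum m f ≡ xorSum m g
xorSum-cong zero    f≗g = refl
xorSum-cong (suc m) f≗g =
  cong₂ _xor_ (f≗g 0 z<s) (xorSum-cong m (λ i i<m → f≗g (suc i) (s<s i<m)))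

xorSum-false : ∀ m {f} → (∀ i → i < m → f i ≡ false) → xorSum m f ≡ false
xorSum-false zero    f≗0 = refl
xorSum-false (suc m) f≗0 =
  cong₂ _xor_ (f≗0 0 z<s) (xorSum-false m (λ i i<m → f≗0 (suc i) (s<s i<m)))

xorSum-single : ∀ m {f} d → d < m → (∀ i → i < m → i ≢ d → f i ≡ false) →
                xorSum m f ≡ f d
xorSum-single (suc m) {f} zero    _       f≗0 =
  trans (cong (f 0 xor_) (xorSum-false m (λ i i<m → f≗0 (suc i) (s<s i<m) λ ())))
        (xor-identityʳ (f 0))
xorSum-single (suc m)     (suc d) d<m f≗0 =
  cong₂ _xor_ (f≗0 0 z<s λ ())
              (xorSum-single m d (s<s⁻¹ d<m) λ i i<m i≢d → f≗0 (suc i) (s<s i<m) (i≢d ∘ suc-injective))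

xorSum-const-odd : ∀ t c → xorSum (suc (t + t)) (λ _ → c) ≡ c
xorSum-const-odd zero    c = xor-identityʳ c
xorSum-const-odd (suc t) c rewrite +-suc t t =
  trans (cong (λ b → c xor (c xor b)) (xorSum-const-odd t c)) (xor-cancelˡ c c)

xorSum-xor : ∀ m f g → xorSum m (λ i → f i xor g i) ≡ xorSum m f xor xorSum m g
xorSum-xor zero    f g = refl
xorSum-xor (suc m) f g =
  trans (cong ((f 0 xor g 0) xor_) (xorSum-xor m (f ∘ suc) (g ∘ suc)))
        (interchange (f 0) (g 0) _ _)

xorSum-telescope : ∀ m (V : ℕ → Bool) → xorSum m (λ i → V i xor V (suc i)) ≡ V 0 xor V m
xorSum-telescope zero    V = sym (xor-same (V 0))
xorSum-telescope (suc m) V = begin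
  (V 0 xor V 1) xor xorSum m (λ i → V (suc i) xor V (suc (suc i)))
    ≡⟨ cong ((V 0 xor V 1) xor_) (xorSum-telescope m (V ∘ suc)) ⟩
  (V 0 xor V 1) xor (V 1 xor V (suc m))
    ≡⟨ xor-assoc (V 0) (V 1) _ ⟩
  V 0 xor (V 1 xor (V 1 xor V (suc m)))
    ≡⟨ cong (V 0 xor_) (xor-cancelˡ (V 1) _) ⟩
  V 0 xor V (suc m)
    ∎

switch : (ℕ → Bool) → (ℕ → ℕ → Bool) → ℕ → ℕ → Bool
switch U s x y = s x y xor (U x xor U y)

pathSign : (ℕ → ℕ → Bool) → (ℕ → ℕ) → ℕ → Bool
pathSign s w m = xorSum m (λ i → s (w i) (w (suc i)))

closedWalkSign : (ℕ → ℕ → Bool) → (ℕ → ℕ) → ℕ → Bool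
closedWalkSign s w m = pathSign s w m xor s (w m) (w 0)

pathSign-switch : ∀ U s w m → pathSign (switch U s) w m ≡ pathSign s w m xor (U (w 0) xor U (w m))
pathSign-switch U s w m =
  trans (xorSum-xor m _ _) (cong (pathSign s w m xor_) (xorSum-telescope m (U ∘ w)))

closedWalkSign-switch : ∀ U s w m → closedWalkSign (switch U s) w m ≡ closedWalkSign s w m
closedWalkSign-switch U s w m = begin
  pathSign (switch U s) w m xor (s (w m) (w 0) xor (U (w m) xor U (w 0)))
    ≡⟨ cong₂ _xor_ (pathSign-switch U s w m) (cong (s (w m) (w 0) xor_) (xor-comm (U (w m)) _)) ⟩
  (pathSign s w m xor D) xor (s (w m) (w 0) xor D)
    ≡⟨ interchange (pathSign s w m) D _ D ⟩
  closedWalkSign s w m xor (D xor D)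
    ≡⟨ cong (closedWalkSign s w m xor_) (xor-same D) ⟩
  closedWalkSign s w m xor false
    ≡⟨ xor-identityʳ _ ⟩
  closedWalkSign s w m
    ∎
  where D = U (w 0) xor U (w m)

extend : ∀ {n} → Signature n → ℕ → ℕ → Bool
extend {n} σ x y with x <? n | y <? n
... | yes x<n | yes y<n = σ (fromℕ< x<n) (fromℕ< y<n)
... | _       | _       = false

extend-toℕ : ∀ {n} (σ : Signature n) i j → extend σ (toℕ i) (toℕ j) ≡ σ i j
extend-toℕ {n} σ i j with toℕ i <? n | toℕ j <? n
... | yes i<n | yes j<n = cong₂ σ (fromℕ<-toℕ i i<n) (fromℕ<-toℕ j j<n)
... | no i≮n  | _       = contradiction (toℕ<n i) i≮n
... | yes _   | no j≮n  = contradiction (toℕ<n j) j≮n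

extend-sym : ∀ {n} {σ : Signature n} → Symmetric σ → ∀ x y → extend σ x y ≡ extend σ y x
extend-sym {n} σ-sym x y with x <? n | y <? n
... | yes x<n | yes y<n = σ-sym _ _
... | yes _   | no _    = refl
... | no _    | yes _   = refl
... | no _    | no _    = refl

InjectiveBelow : ℕ → (ℕ → ℕ) → Set
InjectiveBelow m w = ∀ {i j} → i < m → j < m → w i ≡ w j → i ≡ j

cons : ℕ → (ℕ → ℕ) → ℕ → ℕ
cons x w zero    = x
cons x w (suc i) = w i

cons-injectiveBelow : ∀ {m x w} → InjectiveBelow m w → (∀ i → i < m → w i ≢ x) →
                      InjectiveBelow (suc m) (cons x w)
cons-injectiveBelow inj fresh {zero}  {zero}  _   _   _  = refl
cons-injectiveBelow inj fresh {zero}  {suc j} _   j<m eq = contradiction (sym eq) (fresh j (s<s⁻¹ j<m))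
cons-injectiveBelow inj fresh {suc i} {zero}  i<m _   eq = contradiction eq (fresh i (s<s⁻¹ i<m))
cons-injectiveBelow inj fresh {suc i} {suc j} i<m j<m eq = cong suc (inj (s<s⁻¹ i<m) (s<s⁻¹ j<m) eq)

record ℕCycle (Adj : ℕ → ℕ → Set) (n m : ℕ) : Set where
  field
    walk           : ℕ → ℕ
    walk-<         : ∀ i → i < suc m → walk i < n
    walk-injective : InjectiveBelow (suc m) walk
    walk-step      : ∀ i → i < m → Adj (walk i) (walk (suc i))
    walk-close     : Adj (walk m) (walk 0)

module _ {Adj : ℕ → ℕ → Set} {n m : ℕ} (W : ℕCycle Adj n m) where
  open ℕCycle W

  private
    vertex : Fin (suc m) → Fin n
    vertex j = fromℕ< (walk-< (toℕ j) (toℕ<n j))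

    toℕ-vertex : ∀ j → toℕ (vertex j) ≡ walk (toℕ j)
    toℕ-vertex j = toℕ-fromℕ< _

    adj-vertex : ∀ {i j} → Adj (walk (toℕ i)) (walk (toℕ j)) → Adj (toℕ (vertex i)) (toℕ (vertex j))
    adj-vertex {i} {j} = subst₂ Adj (sym (toℕ-vertex i)) (sym (toℕ-vertex j))

  toCycle : Cycle (λ i j → Adj (toℕ i) (toℕ j)) m
  toCycle = record
    { vert     = vertex
    ; distinct = λ {i} {j} eq → toℕ-injective (walk-injective (toℕ<n i) (toℕ<n j)
                   (trans (sym (toℕ-vertex i)) (trans (cong toℕ eq) (toℕ-vertex j))))
    ; step     = λ j → adj-vertex (subst (λ x → Adj (walk x) (walk (suc (toℕ j)))) (sym (toℕ-inject₁ j))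
                                        (walk-step (toℕ j) (toℕ<n j)))
    ; close    = adj-vertex (subst (λ x → Adj (walk x) (walk 0)) (sym (toℕ-fromℕ m)) walk-close)
    }

  cycleSign-toCycle : (σ : Signature n) → cycleSign σ toCycle ≡ closedWalkSign (extend σ) walk m
  cycleSign-toCycle σ = begin
    foldr _xor_ (σ′ (fromℕ m) fzero) (map edge (tabulate id))
      ≡⟨ cong (foldr _xor_ _) (map-tabulate id edge) ⟩
    foldr _xor_ (σ′ (fromℕ m) fzero) (tabulate edge)
      ≡⟨ foldr-xor-tabulate m edge _ _ edge≗ ⟩
    pathSign (extend σ) walk m xor σ′ (fromℕ m) fzero
      ≡⟨ cong (pathSign (extend σ) walk m xor_) (trans (σ′≡ (fromℕ m) fzero) (cong (λ x → extend σ (walk x) (walk 0)) (toℕ-fromℕ m))) ⟩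
    closedWalkSign (extend σ) walk m
      ∎
    where
    σ′ : Fin (suc m) → Fin (suc m) → Bool
    σ′ i j = σ (vertex i) (vertex j)
    edge : Fin m → Bool
    edge j = σ′ (inject₁ j) (fsuc j)
    σ′≡ : ∀ i j → σ′ i j ≡ extend σ (walk (toℕ i)) (walk (toℕ j))
    σ′≡ i j = trans (sym (extend-toℕ σ (vertex i) (vertex j))) (cong₂ (extend σ) (toℕ-vertex i) (toℕ-vertex j))
    edge≗ : ∀ j → edge j ≡ extend σ (walk (toℕ j)) (walk (suc (toℕ j)))
    edge≗ j = trans (σ′≡ (inject₁ j) (fsuc j)) (cong (λ x → extend σ (walk x) (walk (suc (toℕ j)))) (toℕ-inject₁ j))

all-below-or : ∀ {P : ℕ → Set} {X : Set} N → (∀ i → i < N → P i ⊎ X) → (∀ i → i < N → P i) ⊎ X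
all-below-or zero    f = inj₁ λ _ ()
all-below-or (suc N) f with all-below-or N (λ i i<N → f i (m<n⇒m<1+n i<N)) | f N ≤-refl
... | inj₂ x     | _        = inj₂ x
... | inj₁ _     | inj₂ x   = inj₂ x
... | inj₁ below | inj₁ top = inj₁ λ i i<1+N → [ below i , (λ { refl → top }) ]′ (m<1+n⇒m<n∨m≡n i<1+N)

module _ {Q : ℕ → Set} (t : ℕ → ℕ → Bool) (t-sym : ∀ x y → t x y ≡ t y x)
         (star : ∀ {x y z} → Q x → Q y → Q z → x ≢ y → x ≢ z → y ≢ z → t x y ≡ t x z)
         {x₀ y₀} (Qx₀ : Q x₀) (Qy₀ : Q y₀) (x₀≢y₀ : x₀ ≢ y₀) where

  private
    from-x₀ : ∀ {y} → Q y → x₀ ≢ y → t x₀ y ≡ t x₀ y₀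
    from-x₀ {y} Qy x₀≢y with y ≟ y₀
    ... | yes refl = refl
    ... | no y≢y₀  = star Qx₀ Qy Qy₀ x₀≢y x₀≢y₀ y≢y₀

  starConstant⇒constant : ∀ {x y} → Q x → Q y → x ≢ y → t x y ≡ t x₀ y₀
  starConstant⇒constant {x} {y} Qx Qy x≢y with x ≟ x₀
  ... | yes refl = from-x₀ Qy x≢y
  ... | no x≢x₀  = begin
    t x y   ≡⟨ towards-x₀ ⟩
    t x x₀  ≡⟨ t-sym x x₀ ⟩
    t x₀ x  ≡⟨ from-x₀ Qx (x≢x₀ ∘ sym) ⟩
    t x₀ y₀ ∎
    where
    towards-x₀ : t x y ≡ t x x₀
    towards-x₀ with y ≟ x₀
    ... | yes refl = refl
    ... | no y≢x₀  = star Qx Qy Qx₀ x≢y x≢x₀ y≢x₀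

toℕ≤toℕ-punchIn : ∀ {N} (i : Fin (suc N)) (t : Fin N) → toℕ t ≤ toℕ (punchIn i t)
toℕ≤toℕ-punchIn fzero    t        = n≤1+n (toℕ t)
toℕ≤toℕ-punchIn (fsuc i) fzero    = z≤n
toℕ≤toℕ-punchIn (fsuc i) (fsuc t) = s≤s (toℕ≤toℕ-punchIn i t)

module Avoid₃ {N} {p q r : Fin (3 + N)} (p≢q : p ≢ q) (p≢r : p ≢ r) (q≢r : q ≢ r) where
  private
    q′ = punchOut p≢q
    r′ = punchOut p≢r

    q′≢r′ : q′ ≢ r′
    q′≢r′ eq = q≢r (trans (sym (punchIn-punchOut p≢q)) (trans (cong (punchIn p) eq) (punchIn-punchOut p≢r)))

    r″ = punchOut q′≢r′

  avoid : Fin N → Fin (3 + N)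
  avoid t = punchIn p (punchIn q′ (punchIn r″ t))

  avoid-injective : Injective _≡_ _≡_ avoid
  avoid-injective = punchIn-injective r″ _ _ ∘ punchIn-injective q′ _ _ ∘ punchIn-injective p _ _

  avoid≢p : ∀ t → avoid t ≢ p
  avoid≢p t = punchInᵢ≢i p _

  avoid≢q : ∀ t → avoid t ≢ q
  avoid≢q t eq = punchInᵢ≢i q′ _ (punchIn-injective p _ _ (trans eq (sym (punchIn-punchOut p≢q))))

  avoid≢r : ∀ t → avoid t ≢ r
  avoid≢r t eq = punchInᵢ≢i r″ t (punchIn-injective q′ _ _ (trans
    (punchIn-injective p _ _ (trans eq (sym (punchIn-punchOut p≢r))))
    (sym (punchIn-punchOut q′≢r′))))

  toℕ≤toℕ-avoid : ∀ t → toℕ t ≤ toℕ (avoid t)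
  toℕ≤toℕ-avoid t = ≤-trans (toℕ≤toℕ-punchIn r″ t) (≤-trans (toℕ≤toℕ-punchIn q′ _) (toℕ≤toℕ-punchIn p _))

module _ {v : ℕ} where
  u~Q : ∀ {y} → v ≤ y → HAdjℕ (suc v) 0 y
  u~Q v≤y with m≤n⇒m<n∨m≡n v≤y
  ... | inj₁ v<y  = u-K v<y
  ... | inj₂ refl = uv refl

  Q~u : ∀ {y} → v ≤ y → HAdjℕ (suc v) y 0
  Q~u v≤y with m≤n⇒m<n∨m≡n v≤y
  ... | inj₁ v<y  = K-u v<y
  ... | inj₂ refl = vu refl

  Q~Q : ∀ {x y} → v ≤ x → v ≤ y → x ≢ y → HAdjℕ (suc v) x y
  Q~Q v≤x v≤y x≢y with m≤n⇒m<n∨m≡n v≤x | m≤n⇒m<n∨m≡n v≤y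
  ... | inj₂ refl | _         = v-K refl (≤∧≢⇒< v≤y x≢y)
  ... | inj₁ v<x  | inj₂ refl = K-v refl v<x
  ... | inj₁ v<x  | inj₁ v<y  = clique v<x v<y x≢y

NegativeCycle : ∀ {n} → (Fin n → Fin n → Set) → Signature n → ℕ → Set
NegativeCycle Adj σ m = Σ (Cycle Adj m) λ C → cycleSign σ C ≡ true

-- Q = {v, …, n−1} is the clique K_{n−a} together with v.
module PathSwitching {n} (σ : Signature n) (σ-sym : Symmetric σ) (d : ℕ) where
  v : ℕ
  v = suc d

  U : ℕ → Bool
  U zero    = false
  U (suc x) with x <? d
  ... | yes _ = U x xor extend σ x (suc x)
  ... | no _  = extend σ 0 (suc x)

  τ : ℕ → ℕ → Bool
  τ = switch U (extend σ)

  τ-sym : ∀ x y → τ x y ≡ τ y x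
  τ-sym x y = cong₂ _xor_ (extend-sym σ-sym x y) (xor-comm (U x) (U y))

  τ-path : ∀ {x} → x < d → τ x (suc x) ≡ false
  τ-path {x} x<d with x <? d
  ... | yes _   = trans (cong (extend σ x (suc x) xor_) (xor-cancelˡ (U x) _)) (xor-same (extend σ x (suc x)))
  ... | no x≮d  = contradiction x<d x≮d

  τ-u-Q : ∀ {y} → v ≤ y → τ 0 y ≡ false
  τ-u-Q {suc y} (s≤s d≤y) with y <? d
  ... | yes y<d = contradiction d≤y (<⇒≱ y<d)
  ... | no _    = xor-same (extend σ 0 (suc y))

  τ-Q-u : ∀ {y} → v ≤ y → τ y 0 ≡ false
  τ-Q-u {y} v≤y = trans (τ-sym y 0) (τ-u-Q v≤y)

  InQ : ℕ → Set
  InQ x = v ≤ x × x < n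

  inQ? : ∀ x → Dec (InQ x)
  inQ? x = v ≤? x ×-dec x <? n

  Q≢0 : ∀ {x} → InQ x → x ≢ 0
  Q≢0 (v≤x , _) refl = contradiction v≤x λ ()

  τ-positive⇒balanced : τ d v ≡ false → (∀ {x y} → InQ x → InQ y → x ≢ y → τ x y ≡ false) →
             Balanced (H n (suc v)) σ
  τ-positive⇒balanced last-edge Q-edge = U ∘ toℕ , λ i j i~j →
    trans (cong (_xor (U (toℕ i) xor U (toℕ j))) (sym (extend-toℕ σ i j)))
          (edge (toℕ<n i) (toℕ<n j) i~j)
    where
    path-edge : ∀ {x} → x < v → τ x (suc x) ≡ false
    path-edge x<v with m<1+n⇒m<n∨m≡n x<v
    ... | inj₁ x<d  = τ-path x<d
    ... | inj₂ refl = last-edge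

    edge : ∀ {x y} → x < n → y < n → HAdjℕ (suc v) x y → τ x y ≡ false
    edge _   _   (path→ x<v)            = path-edge (s<s⁻¹ x<v)
    edge _   _   (path← {x} x<v)        = trans (τ-sym (suc x) x) (path-edge (s<s⁻¹ x<v))
    edge _   _   (uv refl)              = τ-u-Q ≤-refl
    edge _   _   (vu refl)              = τ-Q-u ≤-refl
    edge x<n y<n (clique a≤x a≤y x≢y)   = Q-edge (<⇒≤ a≤x , x<n) (<⇒≤ a≤y , y<n) x≢y
    edge _   _   (u-K a≤y)              = τ-u-Q (<⇒≤ a≤y)
    edge _   _   (K-u a≤y)              = τ-Q-u (<⇒≤ a≤y)
    edge x<n y<n (v-K refl a≤y)         = Q-edge (≤-refl , x<n) (<⇒≤ a≤y , y<n) (<⇒≢ a≤y)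
    edge x<n y<n (K-v {x} {y} refl a≤y) =
      trans (τ-sym y x) (Q-edge (≤-refl , y<n) (<⇒≤ a≤y , x<n) (<⇒≢ a≤y))

  sign-in-τ : ∀ {m} (W : ℕCycle (HAdjℕ (suc v)) n m) →
              cycleSign σ (toCycle W) ≡ closedWalkSign τ (ℕCycle.walk W) m
  sign-in-τ {m} W = trans (cycleSign-toCycle W σ) (sym (closedWalkSign-switch U (extend σ) _ m))

  positive-or-negative : ∀ {m} (W : ℕCycle (HAdjℕ (suc v)) n m) →
                         closedWalkSign τ (ℕCycle.walk W) m ≡ false ⊎ NegativeCycle (H n (suc v)) σ m
  positive-or-negative W with cycleSign σ (toCycle W) in eq
  ... | true  = inj₂ (toCycle W , eq)
  ... | false = inj₁ (trans (sym (sign-in-τ W)) eq)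

  uQCycle : ∀ {m} (w : ℕ → ℕ) → (∀ i → i < suc m → InQ (w i)) → InjectiveBelow (suc m) w →
            ℕCycle (HAdjℕ (suc v)) n (suc m)
  uQCycle {m} w w∈Q w-inj = record
    { walk           = cons 0 w
    ; walk-<         = bounded
    ; walk-injective = cons-injectiveBelow w-inj (λ i i<m → Q≢0 (w∈Q i i<m))
    ; walk-step      = adjacent
    ; walk-close     = Q~u (proj₁ (w∈Q m ≤-refl))
    }
    where
    bounded : ∀ i → i < suc (suc m) → cons 0 w i < n
    bounded zero    _   = ≤-<-trans z≤n (proj₂ (w∈Q 0 z<s))
    bounded (suc i) i<m = proj₂ (w∈Q i (s<s⁻¹ i<m))

    adjacent : ∀ i → i < suc m → HAdjℕ (suc v) (cons 0 w i) (cons 0 w (suc i))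
    adjacent zero    _   = u~Q (proj₁ (w∈Q 0 z<s))
    adjacent (suc i) i<m = Q~Q (proj₁ (w∈Q i i<1+m)) (proj₁ (w∈Q (suc i) i<m))
                               (λ eq → 1+n≢n (sym (w-inj i<1+m i<m eq)))
      where i<1+m = m<n⇒m<1+n (s<s⁻¹ i<m)

  uQCycle-sign : ∀ {m} (w : ℕ → ℕ) → v ≤ w 0 → v ≤ w m →
                 closedWalkSign τ (cons 0 w) (suc m) ≡ pathSign τ w m
  uQCycle-sign {m} w v≤w₀ v≤wₘ = begin
    (τ 0 (w 0) xor pathSign τ w m) xor τ (w m) 0
      ≡⟨ cong₂ (λ b c → (b xor pathSign τ w m) xor c) (τ-u-Q v≤w₀) (τ-Q-u v≤wₘ) ⟩
    pathSign τ w m xor false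
      ≡⟨ xor-identityʳ _ ⟩
    pathSign τ w m
      ∎

-- The graph has n = 3 + N vertices, v = d + 1, and the cycles have length m = 2h + 2,
-- i.e. the paper's k is h + 1.
module Construction (N d h : ℕ) (σ : Signature (3 + N)) (σ-sym : Symmetric σ)
                    (d≤1+2h : d ≤ suc (h + h)) (room : suc d + (h + h) < N) where
  open PathSwitching σ σ-sym d

  j : ℕ
  j = h + h

  m : ℕ
  m = suc (suc j)

  Negative : Set
  Negative = NegativeCycle (H (3 + N) (suc v)) σ m

  v≤m : v ≤ m
  v≤m = s≤s d≤1+2h

  m≤v+1+j : m ≤ v + suc j
  m≤v+1+j = s≤s (m≤n+m (suc j) d)

  <3+N : ∀ {x} → x ≤ v + suc j → x < 3 + N
  <3+N x≤ = s≤s (≤-trans x≤ (≤-trans (≤-reflexive (+-suc v j)) (≤-trans room (m≤n+m N 2))))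

  v+i∈Q : ∀ {i} → i ≤ suc j → InQ (v + i)
  v+i∈Q {i} i≤1+j = m≤m+n v i , <3+N (+-monoʳ-≤ v i≤1+j)

  DistinctInQ : ℕ → ℕ → ℕ → Set
  DistinctInQ p q r = InQ p × InQ q × InQ r × p ≢ q × p ≢ r × q ≢ r

  distinctInQ? : ∀ p q r → Dec (DistinctInQ p q r)
  distinctInQ? p q r = inQ? p ×-dec inQ? q ×-dec inQ? r ×-dec ¬? (p ≟ q) ×-dec ¬? (p ≟ r) ×-dec ¬? (q ≟ r)

  StarConstant : Set
  StarConstant = ∀ {p q r} → DistinctInQ p q r → τ p q ≡ τ p r

  Q-constant : StarConstant → ∀ {x y} → InQ x → InQ y → x ≢ y → τ x y ≡ τ (v + 0) (v + 1)
  Q-constant star =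
    starConstant⇒constant τ τ-sym (λ Qx Qy Qz x≢y x≢z y≢z → star (Qx , Qy , Qz , x≢y , x≢z , y≢z))
      (v+i∈Q z≤n) (v+i∈Q (s≤s z≤n)) (λ eq → 1+n≢n (sym (+-cancelˡ-≡ v 0 1 eq)))

  qCycle : ℕCycle (HAdjℕ (suc v)) (3 + N) m
  qCycle = uQCycle (v +_) (λ i i<m → v+i∈Q (m<1+n⇒m≤n i<m)) (λ _ _ → +-cancelˡ-≡ v _ _)

  qCycle-sign : StarConstant → closedWalkSign τ (cons 0 (v +_)) m ≡ τ (v + 0) (v + 1)
  qCycle-sign star = begin
    closedWalkSign τ (cons 0 (v +_)) m
      ≡⟨ uQCycle-sign (v +_) (m≤m+n v 0) (m≤m+n v (suc j)) ⟩
    pathSign τ (v +_) (suc j)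
      ≡⟨ xorSum-cong (suc j) (λ i i<1+j → Q-constant star (v+i∈Q (<⇒≤ i<1+j)) (v+i∈Q i<1+j)
                                            (λ eq → 1+n≢n (sym (+-cancelˡ-≡ v i (suc i) eq)))) ⟩
    xorSum (suc (h + h)) (λ _ → τ (v + 0) (v + 1))
      ≡⟨ xorSum-const-odd h _ ⟩
    τ (v + 0) (v + 1)
      ∎

  pathCycle : ℕCycle (HAdjℕ (suc v)) (3 + N) m
  pathCycle = record
    { walk           = id
    ; walk-<         = λ i i<1+m → <3+N (≤-trans (m<1+n⇒m≤n i<1+m) m≤v+1+j)
    ; walk-injective = λ _ _ → id
    ; walk-step      = adjacent
    ; walk-close     = Q~u v≤m
    }
    where
    adjacent : ∀ i → i < m → HAdjℕ (suc v) i (suc i)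
    adjacent i _ with i <? v
    ... | yes i<v = path→ (s<s i<v)
    ... | no i≮v  = Q~Q (≮⇒≥ i≮v) (m≤n⇒m≤1+n (≮⇒≥ i≮v)) (1+n≢n ∘ sym)

  pathCycle-sign : (∀ {x y} → InQ x → InQ y → x ≢ y → τ x y ≡ false) →
                   closedWalkSign τ id m ≡ τ d v
  pathCycle-sign Q-edge = begin
    xorSum m (λ i → τ i (suc i)) xor τ m 0
      ≡⟨ cong₂ _xor_ (xorSum-single m d (s≤s d≤1+2h) off-last) (τ-Q-u v≤m) ⟩
    τ d v xor false
      ≡⟨ xor-identityʳ _ ⟩
    τ d v
      ∎
    where
    off-last : ∀ i → i < m → i ≢ d → τ i (suc i) ≡ false
    off-last i i<m i≢d with <-cmp i d
    ... | tri< i<d _ _ = τ-path i<d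
    ... | tri≈ _ i≡d _ = contradiction i≡d i≢d
    ... | tri> _ _ v≤i = Q-edge (v≤i , <3+N (≤-trans (<⇒≤ i<m) m≤v+1+j))
                                (m≤n⇒m≤1+n v≤i , <3+N (≤-trans i<m m≤v+1+j)) (1+n≢n ∘ sym)

  module Comparison {p q r} (Qp : InQ p) (Qq : InQ q) (Qr : InQ r)
                    (p≢q : p ≢ q) (p≢r : p ≢ r) (q≢r : q ≢ r) where
    fin : ∀ {x} → InQ x → Fin (3 + N)
    fin Qx = fromℕ< (proj₂ Qx)

    fin-≢ : ∀ {x y} (Qx : InQ x) (Qy : InQ y) → x ≢ y → fin Qx ≢ fin Qy
    fin-≢ Qx Qy x≢y = x≢y ∘ fromℕ<-injective _ _ (proj₂ Qx) (proj₂ Qy)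

    open Avoid₃ (fin-≢ Qp Qq p≢q) (fin-≢ Qp Qr p≢r) (fin-≢ Qq Qr q≢r)

    fill-room : ∀ {i} → i < j → v + i < N
    fill-room i<j = ≤-<-trans (+-monoʳ-≤ v (<⇒≤ i<j)) room

    -- The value 0 for v + i ≥ N is junk: fill is only used below j.
    fill : ℕ → ℕ
    fill i with v + i <? N
    ... | yes v+i<N = toℕ (avoid (fromℕ< v+i<N))
    ... | no _      = 0

    fill-≡ : ∀ {i} (v+i<N : v + i < N) → fill i ≡ toℕ (avoid (fromℕ< v+i<N))
    fill-≡ {i} v+i<N with v + i <? N
    ... | yes _    = refl
    ... | no v+i≮N = contradiction v+i<N v+i≮N

    fill∈Q : ∀ i → i < j → InQ (fill i)
    fill∈Q i i<j rewrite fill-≡ (fill-room i<j) =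
      ≤-trans (m≤m+n v i) (≤-trans (≤-reflexive (sym (toℕ-fromℕ< (fill-room i<j)))) (toℕ≤toℕ-avoid _)) ,
      toℕ<n _

    fill-injective : InjectiveBelow j fill
    fill-injective {i} {i′} i<j i′<j eq =
      +-cancelˡ-≡ v i i′ (fromℕ<-injective _ _ (fill-room i<j) (fill-room i′<j) (avoid-injective (toℕ-injective
        (trans (sym (fill-≡ (fill-room i<j))) (trans eq (fill-≡ (fill-room i′<j)))))))

    fill-avoids : ∀ {x} (Qx : InQ x) → (∀ t → avoid t ≢ fin Qx) → ∀ i → i < j → fill i ≢ x
    fill-avoids Qx avoid≢x i i<j eq = avoid≢x _ (toℕ-injective
      (trans (sym (fill-≡ (fill-room i<j))) (trans eq (sym (toℕ-fromℕ< (proj₂ Qx))))))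

    walkThrough : ℕ → ℕ → ℕ
    walkThrough x = cons x (cons p fill)

    walkThrough∈Q : ∀ {x} → InQ x → ∀ i → i < m → InQ (walkThrough x i)
    walkThrough∈Q Qx zero          _   = Qx
    walkThrough∈Q Qx (suc zero)    _   = Qp
    walkThrough∈Q Qx (suc (suc i)) i<m = fill∈Q i (s<s⁻¹ (s<s⁻¹ i<m))

    comparisonCycle : ∀ {x} (Qx : InQ x) → x ≢ p → (∀ t → avoid t ≢ fin Qx) →
                      ℕCycle (HAdjℕ (suc v)) (3 + N) m
    comparisonCycle {x} Qx x≢p avoid≢x = uQCycle (walkThrough x) (walkThrough∈Q Qx)
      (cons-injectiveBelow (cons-injectiveBelow fill-injective (fill-avoids Qp avoid≢p)) fresh)
      where
      fresh : ∀ i → i < suc j → cons p fill i ≢ x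
      fresh zero    _     = x≢p ∘ sym
      fresh (suc i) i<1+j = fill-avoids Qx avoid≢x i (s<s⁻¹ i<1+j)

    comparisonCycle-sign : ∀ {x} → InQ x →
      closedWalkSign τ (cons 0 (walkThrough x)) m ≡ τ x p xor pathSign τ (cons p fill) j
    comparisonCycle-sign Qx =
      uQCycle-sign {suc j} (walkThrough _) (proj₁ Qx) (proj₁ (walkThrough∈Q Qx (suc j) ≤-refl))

    -- The two cycles differ only in their second vertex, so their signs differ by τ q p ⊕ τ r p.
    sameSign-or-negative : τ p q ≡ τ p r ⊎ Negative
    sameSign-or-negative with positive-or-negative (comparisonCycle Qq (p≢q ∘ sym) avoid≢q)
               | positive-or-negative (comparisonCycle Qr (p≢r ∘ sym) avoid≢r)
    ... | inj₂ C     | _          = inj₂ C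
    ... | inj₁ _     | inj₂ C     = inj₂ C
    ... | inj₁ q-pos | inj₁ r-pos = inj₁ (begin
      τ p q                          ≡⟨ τ-sym p q ⟩
      τ q p                          ≡⟨ xor≡false⇒≡ (trans (sym (comparisonCycle-sign Qq)) q-pos) ⟩
      pathSign τ (cons p fill) j     ≡⟨ sym (xor≡false⇒≡ (trans (sym (comparisonCycle-sign Qr)) r-pos)) ⟩
      τ r p                          ≡⟨ τ-sym r p ⟩
      τ p r                          ∎)

  star-or-negative : StarConstant ⊎ Negative
  star-or-negative =
    map₁ (λ all c@(Qp , Qq , Qr , _) → all _ (proj₂ Qp) _ (proj₂ Qq) _ (proj₂ Qr) c)
      (all-below-or (3 + N) λ p _ → all-below-or (3 + N) λ q _ → all-below-or (3 + N) λ r _ → triple p q r)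
    where
    triple : ∀ p q r → (DistinctInQ p q r → τ p q ≡ τ p r) ⊎ Negative
    triple p q r with distinctInQ? p q r
    ... | no ¬c = inj₁ λ c → contradiction c ¬c
    ... | yes (Qp , Qq , Qr , p≢q , p≢r , q≢r) =
      map₁ (λ eq _ → eq) (Comparison.sameSign-or-negative Qp Qq Qr p≢q p≢r q≢r)

  balanced-if-positive : StarConstant → closedWalkSign τ (cons 0 (v +_)) m ≡ false →
                         closedWalkSign τ id m ≡ false → Balanced (H (3 + N) (suc v)) σ
  balanced-if-positive star q-pos path-pos = τ-positive⇒balanced (trans (sym (pathCycle-sign Q-edge)) path-pos) Q-edge
    where
    Q-edge : ∀ {x y} → InQ x → InQ y → x ≢ y → τ x y ≡ false
    Q-edge Qx Qy x≢y = trans (Q-constant star Qx Qy x≢y) (trans (sym (qCycle-sign star)) q-pos)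

  negativeCycle : Unbalanced (H (3 + N) (suc v)) σ → Negative
  negativeCycle unbalanced with star-or-negative
  ... | inj₂ C    = C
  ... | inj₁ star with positive-or-negative qCycle
  ...   | inj₂ C     = C
  ...   | inj₁ q-pos with positive-or-negative pathCycle
  ...     | inj₂ C        = C
  ...     | inj₁ path-pos = contradiction (balanced-if-positive star q-pos path-pos) unbalanced

2+2h≡2*[1+h] : ∀ h → 2 + (h + h) ≡ 2 * suc h
2+2h≡2*[1+h] = solve-∀

2*[1+h]+1≡3+2h : ∀ h → 2 * suc h + 1 ≡ 3 + (h + h)
2*[1+h]+1≡3+2h = solve-∀

2*[1+h]+[2+d]+1≡5+d+2h : ∀ h d → 2 * suc h + (2 + d) + 1 ≡ 5 + (d + (h + h))
2*[1+h]+[2+d]+1≡5+d+2h = solve-∀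

lemma2p4 : (k n a : ℕ) → 3 ≤ a → a ≤ 2 * k + 1 → 2 * k + a + 1 ≤ n →
    (σ : Signature n) → Symmetric σ → Unbalanced (H n a) σ →
    Σ (Cycle (H n a) (2 * k)) λ C → cycleSign σ C ≡ true
lemma2p4 zero    _ _ 3≤a a≤1 _ _ _ _ = contradiction (≤-trans 3≤a a≤1) λ { (s≤s ()) }
lemma2p4 (suc h) n a 3≤a a≤2k+1 2k+a+1≤n σ σ-sym unbalanced
  with m≤n⇒∃[o]m+o≡n (≤-trans (n≤1+n 2) 3≤a)
     | m≤n⇒∃[o]m+o≡n (≤-trans 3≤a (≤-trans (m≤n+m a (2 * suc h)) (≤-trans (m≤m+n _ 1) 2k+a+1≤n)))
... | d , refl | N , refl =
  subst (NegativeCycle (H (3 + N) (2 + d)) σ) (2+2h≡2*[1+h] h)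
    (Construction.negativeCycle N d h σ σ-sym
      (s≤s⁻¹ (s≤s⁻¹ (subst (2 + d ≤_) (2*[1+h]+1≡3+2h h) a≤2k+1)))
      (s≤s⁻¹ (s≤s⁻¹ (s≤s⁻¹ (subst (_≤ 3 + N) (2*[1+h]+[2+d]+1≡5+d+2h h d) 2k+a+1≤n))))
      unbalanced)
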